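{- For all integers $k\ge 3$ and $n\ge 2$, the snake graph $S_{k,n}$ is odd prime.
   Context: All graphs are finite and simple. An odd prime labeling of a graph $G$ with $N$ vertices is a bijection $\ell:V(G)\to\{1,3,\dots,2N-1\}$ such that $\gcd(\ell(u),\ell(v))=1$ for every edge $uv$; $G$ is odd prime if it has one. The snake graph $S_{k,n}$ consists of a path $v_1,v_2,\dots,v_n$ together with, for each $i=1,\dots,n-1$, new vertices $w_{i,1},\dots,w_{i,k-2}$ forming a path $v_i,w_{i,1},w_{i,2},\dots,w_{i,k-2},v_{i+1}$; thus each edge $v_iv_{i+1}$ lies on a cycle of length $k$, and $S_{k,n}$ has $(k-1)(n-1)+1$ vertices. -}

module Defs where

open import Data.Nat using (ℕ; zero; suc; _+_; _*_; _∸_)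
open import Data.Nat.Coprimality using (Coprime)
open import Data.Fin using (Fin; toℕ)
open import Function.Bundles using (_⤖_; Bijection)
open import Relation.Binary.PropositionalEquality using (_≡_)

-- Vertices of the snake graph S_{k,n}:
--   hub i        : v_{i+1},            i < n
--   inner i j    : w_{i+1,j+1},        i < n-1, j < k-2
data SnakeV (k n : ℕ) : Set where
  hub   : Fin n → SnakeV k n
  inner : Fin (n ∸ 1) → Fin (k ∸ 2) → SnakeV k n

-- Edges of S_{k,n} (stated via ℕ values of indices, avoiding Fin casts).
-- Each edge is listed in one orientation; coprimality is symmetric.
data SnakeE (k n : ℕ) : SnakeV k n → SnakeV k n → Set where
  spine   : (i i' : Fin n) →
            toℕ i' ≡ suc (toℕ i) → SnakeE k n (hub i) (hub i')
  enter   : (i : Fin n) (c : Fin (n ∸ 1)) (j : Fin (k ∸ 2)) →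
            toℕ c ≡ toℕ i → toℕ j ≡ 0 → SnakeE k n (hub i) (inner c j)
  step    : (c : Fin (n ∸ 1)) (j j' : Fin (k ∸ 2)) →
            toℕ j' ≡ suc (toℕ j) → SnakeE k n (inner c j) (inner c j')
  leave   : (c : Fin (n ∸ 1)) (j : Fin (k ∸ 2)) (i' : Fin n) →
            suc (toℕ j) ≡ k ∸ 2 → toℕ i' ≡ suc (toℕ c) → SnakeE k n (inner c j) (hub i')

snakeSize : ℕ → ℕ → ℕ
snakeSize k n = (k ∸ 1) * (n ∸ 1) + 1

odd : {N : ℕ} → Fin N → ℕ
odd m = 2 * toℕ m + 1

-- An odd prime labeling of a graph with vertex type V, adjacency E and N vertices:
-- a bijection V → Fin N (Fin N encoding {1,3,...,2N-1} via odd) such that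
-- adjacent vertices get coprime labels.
record OddPrimeLabeling (V : Set) (E : V → V → Set) (N : ℕ) : Set where
  field
    bij      : V ⤖ Fin N
    coprime  : ∀ {u v} → E u v → Coprime (odd (Bijection.to bij u)) (odd (Bijection.to bij v))

SnakeOddPrime : ℕ → ℕ → Set
SnakeOddPrime k n = OddPrimeLabeling (SnakeV k n) (SnakeE k n) (snakeSize k n)

{-# OPTIONS --safe #-}
module Submission where

open import Defs
open import Data.Nat using (ℕ; zero; suc; _+_; _*_; _≤_; _<_; z≤n; s≤s; NonZero)
open import Data.Nat.Properties
open import Data.Nat.Divisibility using (∣1⇒≡1; ∣m+n∣m⇒∣n; ∣-trans; n∣m*n)
open import Data.Nat.DivMod using (_%_; _/_; m≡m%n+[m/n]*n; m%n<n; [m+kn]%n≡m%n; m<n⇒m%n≡m)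
open import Data.Nat.Coprimality as Coprime using (Coprime; coprime-+)
open import Data.Fin using (Fin; toℕ; fromℕ<)
open import Data.Fin.Properties using (toℕ-fromℕ<; toℕ-injective; toℕ<n)
open import Data.Product using (_×_; _,_; ∃)
open import Function.Bundles using (_⤖_; mk⤖)
open import Relation.Binary.PropositionalEquality

-- Number the vertices along the snake: v_{q+1} ↦ q(k-1) and w_{q+1,j} ↦ q(k-1)+j,
-- a bijection onto {0,…,(k-1)(n-1)} by division with remainder by k-1, and label x
-- by 2x+1.  Every edge joins consecutive numbers, whose labels are consecutive odd
-- numbers, except v_{q+1}v_{q+2}, joining q(k-1) and (q+1)(k-1): a common divisor of
-- those labels divides their difference 2(k-1), hence 2q(k-1), hence 1.

[q*m+1]-coprimeTo-m : ∀ q m → Coprime (q * m + 1) m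
[q*m+1]-coprimeTo-m q m (d∣q*m+1 , d∣m) = ∣1⇒≡1 (∣m+n∣m⇒∣n d∣q*m+1 (∣-trans d∣m (n∣m*n q)))

coprime-[q*m+1]-[[1+q]*m+1] : ∀ q m → Coprime (q * m + 1) (suc q * m + 1)
coprime-[q*m+1]-[[1+q]*m+1] q m =
  Coprime.sym (subst (λ x → Coprime x (q * m + 1)) shift
    (coprime-+ (Coprime.sym ([q*m+1]-coprimeTo-m q m))))
  where
  shift : q * m + 1 + m ≡ suc q * m + 1
  shift = trans (+-comm (q * m + 1) m) (sym (+-assoc m (q * m) 1))

2*[q*c]≡q*[2*c] : ∀ q c → 2 * (q * c) ≡ q * (2 * c)
2*[q*c]≡q*[2*c] q c = trans (sym (*-assoc 2 q c)) (trans (cong (_* c) (*-comm 2 q)) (*-assoc q 2 c))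

odd-coprime-multiples : ∀ q c → Coprime (2 * (q * c) + 1) (2 * (suc q * c) + 1)
odd-coprime-multiples q c =
  subst₂ (λ x y → Coprime (x + 1) (y + 1))
    (sym (2*[q*c]≡q*[2*c] q c)) (sym (2*[q*c]≡q*[2*c] (suc q) c))
    (coprime-[q*m+1]-[[1+q]*m+1] q (2 * c))

odd-coprime-suc : ∀ u → Coprime (2 * u + 1) (2 * suc u + 1)
odd-coprime-suc u =
  subst₂ (λ x y → Coprime (2 * x + 1) (2 * y + 1)) (*-identityʳ u) (*-identityʳ (suc u))
    (odd-coprime-multiples u 1)

odd-coprime-≡suc : ∀ {u v} → v ≡ suc u → Coprime (2 * u + 1) (2 * v + 1)
odd-coprime-≡suc {u} refl = odd-coprime-suc u

remQuot-injective : ∀ K .{{_ : NonZero K}} {r r' q q'} → r < K → r' < K →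
                    r + q * K ≡ r' + q' * K → r ≡ r' × q ≡ q'
remQuot-injective K {r} {r'} {q} {q'} r<K r'<K eq = r≡r' , q≡q'
  where
  r≡r' : r ≡ r'
  r≡r' = begin
    r                   ≡⟨ m<n⇒m%n≡m r<K ⟨
    r % K               ≡⟨ [m+kn]%n≡m%n r q K ⟨
    (r + q * K) % K     ≡⟨ cong (_% K) eq ⟩
    (r' + q' * K) % K   ≡⟨ [m+kn]%n≡m%n r' q' K ⟩
    r' % K              ≡⟨ m<n⇒m%n≡m r'<K ⟩
    r'                  ∎
    where open ≡-Reasoning
  q≡q' : q ≡ q'
  q≡q' = *-cancelʳ-≡ q q' K (+-cancelˡ-≡ r _ _ (trans eq (cong (_+ q' * K) (sym r≡r'))))

module SnakeLabeling (a b : ℕ) where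
  k n K N : ℕ
  k = suc (suc a)
  n = suc b
  K = suc a
  N = snakeSize k n

  V : Set
  V = SnakeV k n

  rem quot index : V → ℕ
  rem (hub i)       = 0
  rem (inner c j)   = suc (toℕ j)
  quot (hub i)      = toℕ i
  quot (inner c j)  = toℕ c
  index v = rem v + quot v * K

  rem<K : ∀ v → rem v < K
  rem<K (hub i)     = s≤s z≤n
  rem<K (inner c j) = s≤s (toℕ<n j)

  index≤K*b : ∀ v → index v ≤ K * b
  index≤K*b (hub i)     = subst (toℕ i * K ≤_) (*-comm b K) (*-monoˡ-≤ K (m<1+n⇒m≤n (toℕ<n i)))
  index≤K*b (inner c j) = begin
    suc (toℕ j) + toℕ c * K ≤⟨ +-monoˡ-≤ (toℕ c * K) (m≤n⇒m≤1+n (toℕ<n j)) ⟩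
    suc (toℕ c) * K         ≤⟨ *-monoˡ-≤ K (toℕ<n c) ⟩
    b * K                   ≡⟨ *-comm b K ⟩
    K * b                   ∎
    where open ≤-Reasoning

  index<N : ∀ v → index v < N
  index<N v = subst (index v <_) (+-comm 1 (K * b)) (s≤s (index≤K*b v))

  label : V → Fin N
  label v = fromℕ< (index<N v)

  toℕ-label : ∀ v → toℕ (label v) ≡ index v
  toℕ-label v = toℕ-fromℕ< (index<N v)

  index-injective : ∀ {u v} → index u ≡ index v → u ≡ v
  index-injective {u} {v} eq with remQuot-injective K {q = quot u} {quot v} (rem<K u) (rem<K v) eq
  index-injective {hub i}     {hub i'}      eq | _     , q≡q' = cong hub (toℕ-injective q≡q')
  index-injective {hub i}     {inner c j}   eq | () , _
  index-injective {inner c j} {hub i}       eq | () , _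
  index-injective {inner c j} {inner c' j'} eq | r≡r' , q≡q' =
    cong₂ inner (toℕ-injective q≡q') (toℕ-injective (suc-injective r≡r'))

  label-injective : ∀ {u v} → label u ≡ label v → u ≡ v
  label-injective {u} {v} eq =
    index-injective (trans (sym (toℕ-label u)) (trans (cong toℕ eq) (toℕ-label v)))

  vertexWithRemQuot : ∀ r q → r < K → r + q * K ≤ K * b → ∃ λ v → index v ≡ r + q * K
  vertexWithRemQuot zero q _ bound =
    hub (fromℕ< q<n) , cong (_* K) (toℕ-fromℕ< q<n)
    where
    q<n : q < n
    q<n = s≤s (*-cancelʳ-≤ q b K (subst (q * K ≤_) (*-comm K b) bound))
  vertexWithRemQuot (suc r) q r<K bound =
    inner (fromℕ< q<b) (fromℕ< r<a) ,
    cong₂ (λ x y → suc x + y * K) (toℕ-fromℕ< r<a) (toℕ-fromℕ< q<b)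
    where
    r<a : r < a
    r<a = m<1+n⇒m≤n r<K
    q<b : q < b
    q<b = *-cancelʳ-< K q b (begin-strict
      q * K               <⟨ s≤s (m≤n+m (q * K) r) ⟩
      suc r + q * K       ≤⟨ bound ⟩
      K * b               ≡⟨ *-comm K b ⟩
      b * K               ∎)
      where open ≤-Reasoning

  label-surjective : ∀ m → ∃ λ v → ∀ {u} → u ≡ v → label u ≡ m
  label-surjective m with vertexWithRemQuot (toℕ m % K) (toℕ m / K) (m%n<n (toℕ m) K) bound
    where
    bound : toℕ m % K + toℕ m / K * K ≤ K * b
    bound = subst (_≤ K * b) (m≡m%n+[m/n]*n (toℕ m) K)
              (m<1+n⇒m≤n (subst (toℕ m <_) (+-comm (K * b) 1) (toℕ<n m)))
  ... | v , index-v = v , λ { refl → toℕ-injective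
                                (trans (toℕ-label v) (trans index-v (sym (m≡m%n+[m/n]*n (toℕ m) K)))) }

  labelling : V ⤖ Fin N
  labelling = mk⤖ (label-injective , label-surjective)

  index-coprime : ∀ {u v} → SnakeE k n u v → Coprime (2 * index u + 1) (2 * index v + 1)
  index-coprime (spine i i' i'≡1+i) =
    subst (λ x → Coprime _ (2 * (x * K) + 1)) (sym i'≡1+i) (odd-coprime-multiples (toℕ i) K)
  index-coprime (enter i c j c≡i j≡0) =
    odd-coprime-≡suc (cong₂ (λ x y → suc (x + y * K)) j≡0 c≡i)
  index-coprime (step c j j' j'≡1+j) =
    odd-coprime-≡suc (cong (λ x → suc x + toℕ c * K) j'≡1+j)
  index-coprime (leave c j i' 1+j≡a i'≡1+c) =
    odd-coprime-≡suc (trans (cong (_* K) i'≡1+c) (cong (λ x → suc x + toℕ c * K) (sym 1+j≡a)))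

  oddPrime : SnakeOddPrime k n
  oddPrime = record
    { bij     = labelling
    ; coprime = λ {u} {v} e →
        subst₂ (λ x y → Coprime (2 * x + 1) (2 * y + 1))
          (sym (toℕ-label u)) (sym (toℕ-label v)) (index-coprime e)
    }

mainTheorem2 : (k n : ℕ) → 3 ≤ k → 2 ≤ n → SnakeOddPrime k n
mainTheorem2 (suc (suc (suc a))) (suc (suc b)) (s≤s (s≤s (s≤s _))) (s≤s (s≤s _)) =
  SnakeLabeling.oddPrime (suc a) (suc b)
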